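{- Let $n\ge 2$, let $q$ be a prime power, and let $S_0=\{A=(a_{ij})\in UU_n(\mathbb{F}_q)\mid \prod_{i=1}^{n-1}a_{i,i+1}\neq 0\}$. Then \[\omega(S_0)=(q-1)^{n-2}q^{\binom{n-2}{2}}.\]
   Context: $UU_n(\mathbb{F}_q)$ is the group of $n\times n$ upper triangular matrices over $\mathbb{F}_q$ with all diagonal entries $1$. A subset is non-commuting if any two distinct elements do not commute; $\omega(A)$ is the maximum cardinality of a non-commuting subset of $A$. -}

module Defs where

open import Level using (Level; _⊔_)
open import Data.Nat using (ℕ; zero; suc; _^_)
open import Data.Nat.Primality using (Prime)
open import Data.Fin using (Fin; toℕ; inject₁; suc)
import Data.Fin as Fin
open import Data.Product using (Σ; ∃; _×_)
open import Data.Vec.Functional using (foldr)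
open import Relation.Nullary using (¬_)
open import Relation.Binary.PropositionalEquality using (_≡_; _≢_)
import Relation.Binary.PropositionalEquality as ≡
open import Function.Bundles using (Inverse)
open import Algebra.Bundles using (CommutativeRing)

IsPrimePower : ℕ → Set
IsPrimePower q = Σ ℕ λ p → Σ ℕ λ k → Prime p × q ≡ p ^ suc k

record IsFiniteField {c ℓ} (F : CommutativeRing c ℓ) (q : ℕ) : Set (c ⊔ ℓ) where
  open CommutativeRing F
  field
    0≉1      : ¬ (0# ≈ 1#)
    inverse  : ∀ x → ¬ (x ≈ 0#) → Σ Carrier λ y → x * y ≈ 1#
    counting : Inverse setoid (≡.setoid (Fin q))

module Matrices {c ℓ} (F : CommutativeRing c ℓ) where
  open CommutativeRing F

  Mat : ℕ → Set c
  Mat n = Fin n → Fin n → Carrier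

  Σ[_] : ∀ {n} → (Fin n → Carrier) → Carrier
  Σ[ f ] = foldr _+_ 0# f

  Π[_] : ∀ {n} → (Fin n → Carrier) → Carrier
  Π[ f ] = foldr _*_ 1# f

  _·_ : ∀ {n} → Mat n → Mat n → Mat n
  (A · B) i j = Σ[ (λ k → A i k * B k j) ]

  IsUU : ∀ {n} → Mat n → Set ℓ
  IsUU A = (∀ i → A i i ≈ 1#) × (∀ i j → toℕ j Data.Nat.< toℕ i → A i j ≈ 0#)
    where import Data.Nat

  superdiagProd : ∀ {n} → Mat n → Carrier
  superdiagProd {zero}  A = 1#
  superdiagProd {suc m} A = Π[ (λ (i : Fin m) → A (inject₁ i) (suc i)) ]

  InS₀ : ∀ {n} → Mat n → Set ℓ
  InS₀ A = IsUU A × ¬ (superdiagProd A ≈ 0#)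

  Commute : ∀ {n} → Mat n → Mat n → Set ℓ
  Commute A B = ∀ i j → (A · B) i j ≈ (B · A) i j

  -- a family of m elements of S₀, any two (at distinct positions) non-commuting
  -- (this forces the elements to be distinct, so it is a non-commuting subset of size m)
  NonCommutingFamilyInS₀ : ∀ {n} (m : ℕ) → (Fin m → Mat n) → Set ℓ
  NonCommutingFamilyInS₀ m X =
    (∀ a → InS₀ (X a)) × (∀ a b → a ≢ b → ¬ Commute (X a) (X b))

  ωS₀≡ : ℕ → ℕ → Set (c ⊔ ℓ)
  ωS₀≡ n N =
    (Σ (Fin N → Mat n) λ X → NonCommutingFamilyInS₀ N X)
    × (∀ m (X : Fin m → Mat n) → NonCommutingFamilyInS₀ m X → m Data.Nat.≤ N)
    where import Data.Nat

module Submission where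

-- Writing A = I + N, A lies in S₀ iff N is a regular nilpotent (strictly upper,
-- nonzero superdiagonal), and A, B commute iff their nilpotent parts do
-- (MatrixAlgebra, NilpotentMatrices).  Over a field (OverAField), a matrix
-- commuting with a regular N is determined by its first row, since row 0 of Nᵗ
-- is nonzero exactly from column t on; and every row (0, v₁, …) is the first row
-- of a polynomial in N.  So the strictly upper centralizer of N is commutative,
-- and the polynomial in N with first row e₁ = (0,1,0,…,0) is a regular normal
-- form such that equal normal forms force commutation.  Its lower-right block
-- therefore maps a non-commuting family injectively into the regular nilpotents
-- of size n-1, counted in Count/Enumeration; conversely the I + N with N of first
-- row e₁ are pairwise non-commuting (NonCommutingFamilies).

open import Level using (_⊔_)
open import Defs
open import Data.Nat as ℕ using (ℕ; zero; suc; z≤n; s≤s)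
import Data.Nat.Properties as ℕP
open import Data.Nat.Combinatorics using (_C_; nC1≡n; nCk+nC[k+1]≡[n+1]C[k+1])
open import Data.Fin as Fin using (Fin; toℕ; inject₁; fromℕ; punchIn; combine; remQuot; funToFin; finToFun)
  renaming (zero to fz; suc to fs)
import Data.Fin.Properties as FinP
open import Data.Fin.Induction using (>-wellFounded; <-weakInduction)
import Induction.WellFounded as WF
open import Data.Product using (Σ; _×_; _,_; proj₁; proj₂)
open import Data.Sum using (inj₁; inj₂)
open import Data.Empty using (⊥-elim)
open import Function using (_∘_)
open import Function.Bundles using (Inverse)
open import Function.Definitions using (Injective)
open import Relation.Nullary using (¬_; yes; no)
open import Relation.Binary.PropositionalEquality as ≡ using (_≡_; _≢_)
open import Algebra.Bundles using (CommutativeRing)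

record IsField {c ℓ} (F : CommutativeRing c ℓ) : Set (c ⊔ ℓ) where
  open CommutativeRing F
  field
    0≉1     : ¬ (0# ≈ 1#)
    inverse : ∀ x → ¬ (x ≈ 0#) → Σ Carrier λ y → x * y ≈ 1#

finite⇒field : ∀ {c ℓ} {F : CommutativeRing c ℓ} {q} → IsFiniteField F q → IsField F
finite⇒field ff = record { 0≉1 = IsFiniteField.0≉1 ff ; inverse = IsFiniteField.inverse ff }

module MatrixAlgebra {c ℓ} (F : CommutativeRing c ℓ) where
  open CommutativeRing F
  open Matrices F
  open import Algebra.Properties.Group +-group using (∙-cancelˡ; ∙-cancelʳ; //-rightDividesˡ)
  open import Algebra.Properties.CommutativeSemigroup +-commutativeSemigroup using (xy∙z≈xz∙y)
  open import Algebra.Properties.CommutativeSemigroup *-commutativeSemigroup using (x∙yz≈y∙xz)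
  -- Σ[_] of Defs is definitionally the library's `sum`, so its lemmas apply.
  open import Algebra.Properties.Semiring.Sum semiring
    using (sum-cong-≋; sum-replicate-zero; sum-remove; ∑-distrib-+; ∑-comm; *-distribˡ-sum; *-distribʳ-sum)
  open import Relation.Binary.Reasoning.Setoid setoid

  sum-zero : ∀ {n} {f : Fin n → Carrier} → (∀ i → f i ≈ 0#) → Σ[ f ] ≈ 0#
  sum-zero {n} f≈0 = trans (sum-cong-≋ f≈0) (sum-replicate-zero n)

  sum-single : ∀ {n} {f : Fin n → Carrier} (k : Fin n) → (∀ l → l ≢ k → f l ≈ 0#) → Σ[ f ] ≈ f k
  sum-single {suc n} {f} k f≈0 = begin
    Σ[ f ]                  ≈⟨ sum-remove {i = k} f ⟩
    f k + Σ[ f ∘ punchIn k ] ≈⟨ +-congˡ (sum-zero (λ l → f≈0 _ (FinP.punchInᵢ≢i k l))) ⟩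
    f k + 0#                ≈⟨ +-identityʳ (f k) ⟩
    f k                     ∎

  sum-cancel : ∀ {n} {f g : Fin n → Carrier} (k : Fin n) → (∀ l → l ≢ k → f l ≈ g l) →
               Σ[ f ] ≈ Σ[ g ] → f k ≈ g k
  sum-cancel {suc n} {f} {g} k f≈g sums = ∙-cancelʳ (Σ[ f ∘ punchIn k ]) (f k) (g k) (begin
    f k + Σ[ f ∘ punchIn k ] ≈⟨ sum-remove {i = k} f ⟨
    Σ[ f ]                   ≈⟨ sums ⟩
    Σ[ g ]                   ≈⟨ sum-remove {i = k} g ⟩
    g k + Σ[ g ∘ punchIn k ] ≈⟨ +-congˡ (sum-cong-≋ (λ l → sym (f≈g _ (FinP.punchInᵢ≢i k l)))) ⟩
    g k + Σ[ f ∘ punchIn k ] ∎)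

  infix  4 _≋_
  infixl 6 _⊕_ _⊖_
  infixr 7 _⊛_

  _≋_ : ∀ {n} → Mat n → Mat n → Set ℓ
  A ≋ B = ∀ i j → A i j ≈ B i j

  _⊕_ _⊖_ : ∀ {n} → Mat n → Mat n → Mat n
  (A ⊕ B) i j = A i j + B i j
  (A ⊖ B) i j = A i j - B i j

  _⊛_ : ∀ {n} → Carrier → Mat n → Mat n
  (e ⊛ A) i j = e * A i j

  𝟎 : ∀ {n} → Mat n
  𝟎 i j = 0#

  I : ∀ {n} → Mat n
  I fz     fz     = 1#
  I fz     (fs j) = 0#
  I (fs i) fz     = 0#
  I (fs i) (fs j) = I i j

  I-diagonal : ∀ {n} (i : Fin n) → I i i ≡ 1#
  I-diagonal fz     = ≡.refl
  I-diagonal (fs i) = I-diagonal i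

  I-offdiagonal : ∀ {n} (i j : Fin n) → i ≢ j → I i j ≡ 0#
  I-offdiagonal fz     fz     i≢j = ⊥-elim (i≢j ≡.refl)
  I-offdiagonal fz     (fs j) i≢j = ≡.refl
  I-offdiagonal (fs i) fz     i≢j = ≡.refl
  I-offdiagonal (fs i) (fs j) i≢j = I-offdiagonal i j (i≢j ∘ ≡.cong fs)

  I-below : ∀ {n} (i j : Fin n) → toℕ j ℕ.< toℕ i → I i j ≡ 0#
  I-below i j j<i = I-offdiagonal i j (λ { ≡.refl → ℕP.<-irrefl ≡.refl j<i })

  I-superdiagonal : ∀ {n} (i j : Fin n) → toℕ j ≡ suc (toℕ i) → I i j ≡ 0#
  I-superdiagonal i j j≡ = I-offdiagonal i j (λ { ≡.refl → ℕP.1+n≢n (≡.sym j≡) })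

  pow : ∀ {n} → Mat n → ℕ → Mat n
  pow N zero    = I
  pow N (suc t) = pow N t · N

  ·-cong : ∀ {n} {A A′ B B′ : Mat n} → A ≋ A′ → B ≋ B′ → A · B ≋ A′ · B′
  ·-cong A≋ B≋ i j = sum-cong-≋ (λ k → *-cong (A≋ i k) (B≋ k j))

  ·-assoc : ∀ {n} (A B C : Mat n) → (A · B) · C ≋ A · (B · C)
  ·-assoc A B C i j = begin
    Σ[ (λ l → Σ[ (λ k → A i k * B k l) ] * C l j) ]
      ≈⟨ sum-cong-≋ (λ l → *-distribʳ-sum (C l j) (λ k → A i k * B k l)) ⟩
    Σ[ (λ l → Σ[ (λ k → A i k * B k l * C l j) ]) ]
      ≈⟨ ∑-comm (λ l k → A i k * B k l * C l j) ⟩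
    Σ[ (λ k → Σ[ (λ l → A i k * B k l * C l j) ]) ]
      ≈⟨ sum-cong-≋ (λ k → sum-cong-≋ (λ l → *-assoc (A i k) (B k l) (C l j))) ⟩
    Σ[ (λ k → Σ[ (λ l → A i k * (B k l * C l j)) ]) ]
      ≈⟨ sum-cong-≋ (λ k → *-distribˡ-sum (A i k) (λ l → B k l * C l j)) ⟨
    Σ[ (λ k → A i k * Σ[ (λ l → B k l * C l j) ]) ] ∎

  ·-distribˡ : ∀ {n} (A B C : Mat n) → A · (B ⊕ C) ≋ A · B ⊕ A · C
  ·-distribˡ A B C i j = trans (sum-cong-≋ (λ k → distribˡ (A i k) (B k j) (C k j)))
                                (∑-distrib-+ (λ k → A i k * B k j) (λ k → A i k * C k j))

  ·-distribʳ : ∀ {n} (A B C : Mat n) → (B ⊕ C) · A ≋ B · A ⊕ C · A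
  ·-distribʳ A B C i j = trans (sum-cong-≋ (λ k → distribʳ (A k j) (B i k) (C i k)))
                                (∑-distrib-+ (λ k → B i k * A k j) (λ k → C i k * A k j))

  ·-scalarˡ : ∀ {n} (e : Carrier) (A B : Mat n) → (e ⊛ A) · B ≋ e ⊛ (A · B)
  ·-scalarˡ e A B i j =
    trans (sum-cong-≋ (λ k → *-assoc e (A i k) (B k j))) (sym (*-distribˡ-sum e (λ k → A i k * B k j)))

  ·-scalarʳ : ∀ {n} (e : Carrier) (A B : Mat n) → A · (e ⊛ B) ≋ e ⊛ (A · B)
  ·-scalarʳ e A B i j =
    trans (sum-cong-≋ (λ k → x∙yz≈y∙xz (A i k) e (B k j))) (sym (*-distribˡ-sum e (λ k → A i k * B k j)))

  ·-row : ∀ {n} {A A′ : Mat n} (B : Mat n) i → (∀ k → A i k ≈ A′ i k) →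
          ∀ j → (A · B) i j ≈ (A′ · B) i j
  ·-row B i rows j = sum-cong-≋ (λ k → *-congʳ (rows k))

  ·-zeroˡ : ∀ {n} (A : Mat n) → 𝟎 · A ≋ 𝟎
  ·-zeroˡ A i j = sum-zero (λ k → zeroˡ (A k j))

  ·-zeroʳ : ∀ {n} (A : Mat n) → A · 𝟎 ≋ 𝟎
  ·-zeroʳ A i j = sum-zero (λ k → zeroʳ (A i k))

  ·-identityˡ : ∀ {n} (A : Mat n) → I · A ≋ A
  ·-identityˡ A i j = begin
    Σ[ (λ k → I i k * A k j) ]
      ≈⟨ sum-single i (λ k k≢i → trans (*-congʳ (reflexive (I-offdiagonal i k (k≢i ∘ ≡.sym)))) (zeroˡ _)) ⟩
    I i i * A i j              ≈⟨ *-congʳ (reflexive (I-diagonal i)) ⟩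
    1# * A i j                 ≈⟨ *-identityˡ (A i j) ⟩
    A i j                      ∎

  ·-identityʳ : ∀ {n} (A : Mat n) → A · I ≋ A
  ·-identityʳ A i j = begin
    Σ[ (λ k → A i k * I k j) ]
      ≈⟨ sum-single j (λ k k≢j → trans (*-congˡ (reflexive (I-offdiagonal k j k≢j))) (zeroʳ _)) ⟩
    A i j * I j j              ≈⟨ *-congˡ (reflexive (I-diagonal j)) ⟩
    A i j * 1#                 ≈⟨ *-identityʳ (A i j) ⟩
    A i j                      ∎

  +-difference : ∀ x y → x + (y - x) ≈ y
  +-difference x y = trans (+-comm x (y - x)) (//-rightDividesˡ x y)

  I⊕⊖I : ∀ {n} (A : Mat n) → A ≋ I ⊕ (A ⊖ I)
  I⊕⊖I A i j = sym (+-difference (I i j) (A i j))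

  commute-refl : ∀ {n} {X : Mat n} → Commute X X
  commute-refl i j = refl

  commute-sym : ∀ {n} {X Y : Mat n} → Commute X Y → Commute Y X
  commute-sym XY i j = sym (XY i j)

  commute-cong : ∀ {n} {X X′ Y Y′ : Mat n} → X ≋ X′ → Y ≋ Y′ → Commute X Y → Commute X′ Y′
  commute-cong X≋ Y≋ XY i j = trans (sym (·-cong X≋ Y≋ i j)) (trans (XY i j) (·-cong Y≋ X≋ i j))

  commute-⊕ : ∀ {n} {X A B : Mat n} → Commute X A → Commute X B → Commute X (A ⊕ B)
  commute-⊕ {X = X} {A} {B} XA XB i j =
    trans (·-distribˡ X A B i j) (trans (+-cong (XA i j) (XB i j)) (sym (·-distribʳ X A B i j)))

  commute-⊛ : ∀ {n} {X A : Mat n} (e : Carrier) → Commute X A → Commute X (e ⊛ A)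
  commute-⊛ {X = X} {A} e XA i j =
    trans (·-scalarʳ e X A i j) (trans (*-congˡ (XA i j)) (sym (·-scalarˡ e A X i j)))

  commute-𝟎 : ∀ {n} {X : Mat n} → Commute X 𝟎
  commute-𝟎 {X = X} i j = trans (·-zeroʳ X i j) (sym (·-zeroˡ X i j))

  commute-pow : ∀ {n} {X N : Mat n} → Commute X N → ∀ t → Commute X (pow N t)
  commute-pow {X = X} XN zero i j = trans (·-identityʳ X i j) (sym (·-identityˡ X i j))
  commute-pow {X = X} {N} XN (suc t) i j = begin
    (X · (pow N t · N)) i j ≈⟨ ·-assoc X (pow N t) N i j ⟨
    ((X · pow N t) · N) i j ≈⟨ ·-cong {B = N} (commute-pow XN t) (λ _ _ → refl) i j ⟩
    ((pow N t · X) · N) i j ≈⟨ ·-assoc (pow N t) X N i j ⟩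
    (pow N t · (X · N)) i j ≈⟨ ·-cong {A = pow N t} (λ _ _ → refl) XN i j ⟩
    (pow N t · (N · X)) i j ≈⟨ ·-assoc (pow N t) N X i j ⟨
    ((pow N t · N) · X) i j ∎

  unipotent-product : ∀ {n} (M N : Mat n) i j →
                      ((I ⊕ M) · (I ⊕ N)) i j ≈ ((I i j + M i j) + N i j) + (M · N) i j
  unipotent-product M N i j = begin
    ((I ⊕ M) · (I ⊕ N)) i j                    ≈⟨ ·-distribˡ (I ⊕ M) I N i j ⟩
    ((I ⊕ M) · I) i j + ((I ⊕ M) · N) i j      ≈⟨ +-cong (·-identityʳ (I ⊕ M) i j) (·-distribʳ N I M i j) ⟩
    (I i j + M i j) + ((I · N) i j + (M · N) i j) ≈⟨ +-congˡ (+-congʳ (·-identityˡ N i j)) ⟩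
    (I i j + M i j) + (N i j + (M · N) i j)     ≈⟨ +-assoc _ _ _ ⟨
    ((I i j + M i j) + N i j) + (M · N) i j     ∎

  commute-unipotent⁺ : ∀ {n} {M N : Mat n} → Commute M N → Commute (I ⊕ M) (I ⊕ N)
  commute-unipotent⁺ {M = M} {N} MN i j = begin
    ((I ⊕ M) · (I ⊕ N)) i j                 ≈⟨ unipotent-product M N i j ⟩
    ((I i j + M i j) + N i j) + (M · N) i j ≈⟨ +-cong (xy∙z≈xz∙y _ _ _) (MN i j) ⟩
    ((I i j + N i j) + M i j) + (N · M) i j ≈⟨ unipotent-product N M i j ⟨
    ((I ⊕ N) · (I ⊕ M)) i j                 ∎

  commute-unipotent⁻ : ∀ {n} {M N : Mat n} → Commute (I ⊕ M) (I ⊕ N) → Commute M N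
  commute-unipotent⁻ {M = M} {N} MN i j = ∙-cancelˡ ((I i j + M i j) + N i j) _ _ (begin
    ((I i j + M i j) + N i j) + (M · N) i j ≈⟨ unipotent-product M N i j ⟨
    ((I ⊕ M) · (I ⊕ N)) i j                 ≈⟨ MN i j ⟩
    ((I ⊕ N) · (I ⊕ M)) i j                 ≈⟨ unipotent-product N M i j ⟩
    ((I i j + N i j) + M i j) + (N · M) i j ≈⟨ +-congʳ (xy∙z≈xz∙y _ _ _) ⟩
    ((I i j + M i j) + N i j) + (N · M) i j ∎)

  commute-⊖I : ∀ {n} {A B : Mat n} → Commute (A ⊖ I) (B ⊖ I) → Commute A B
  commute-⊖I {A = A} {B} c =
    commute-cong (λ i j → sym (I⊕⊖I A i j)) (λ i j → sym (I⊕⊖I B i j)) (commute-unipotent⁺ c)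

-- Strictly upper triangular matrices, their powers, and polynomials in them,
-- over an arbitrary commutative ring.
module NilpotentMatrices {c ℓ} (F : CommutativeRing c ℓ) where
  open CommutativeRing F
  open Matrices F
  open MatrixAlgebra F
  open import Relation.Binary.Reasoning.Setoid setoid

  StrictlyUpper : ∀ {n} → Mat n → Set ℓ
  StrictlyUpper N = ∀ i j → toℕ j ℕ.≤ toℕ i → N i j ≈ 0#

  NonzeroSuperdiagonal : ∀ {n} → Mat n → Set ℓ
  NonzeroSuperdiagonal N = ∀ i j → toℕ j ≡ suc (toℕ i) → ¬ (N i j ≈ 0#)

  record Regular {n} (N : Mat n) : Set ℓ where
    field
      upper         : StrictlyUpper N
      superdiagonal : NonzeroSuperdiagonal N
  open Regular public

  corner-nonzero : ∀ {k} {N : Mat (suc (suc k))} → Regular N → ¬ (N fz (fs fz) ≈ 0#)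
  corner-nonzero N-reg = superdiagonal N-reg fz (fs fz) ≡.refl

  pow-vanishes : ∀ {n} {N : Mat n} → StrictlyUpper N → ∀ t i j → toℕ j ℕ.< t ℕ.+ toℕ i → pow N t i j ≈ 0#
  pow-vanishes N↑ zero i j j<i = reflexive (I-below i j j<i)
  pow-vanishes {N = N} N↑ (suc t) i j j≤t+i = sum-zero term
    where
    term : ∀ l → pow N t i l * N l j ≈ 0#
    term l with toℕ l ℕ.<? t ℕ.+ toℕ i
    ... | yes l<t+i = trans (*-congʳ (pow-vanishes N↑ t i l l<t+i)) (zeroˡ (N l j))
    ... | no  l≮t+i = trans (*-congˡ (N↑ l j (ℕP.≤-trans (ℕ.s≤s⁻¹ j≤t+i) (ℕP.≮⇒≥ l≮t+i)))) (zeroʳ (pow N t i l))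

  first-row-vanishes : ∀ {K} {N : Mat (suc K)} → StrictlyUpper N → ∀ t l → toℕ l ℕ.< t → pow N t fz l ≈ 0#
  first-row-vanishes N↑ t l l<t = pow-vanishes N↑ t fz l (≡.subst (toℕ l ℕ.<_) (≡.sym (ℕP.+-identityʳ t)) l<t)

  -- The contribution of the term e·Nᵗ⁺¹ to the coefficient of N.
  linearCoefficient : Carrier → ℕ → Carrier
  linearCoefficient e zero    = e
  linearCoefficient e (suc t) = 0#

  -- `Poly N P a`: P is a polynomial in N without constant term, with coefficient a at N.
  data Poly {n} (N : Mat n) : Mat n → Carrier → Set (c ⊔ ℓ) where
    none    : Poly N 𝟎 0#
    addTerm : ∀ {P a} → Poly N P a → (e : Carrier) (t : ℕ) →
              Poly N (P ⊕ e ⊛ pow N (suc t)) (a + linearCoefficient e t)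

  poly-commute : ∀ {n} {X N P : Mat n} {a} → Commute X N → Poly N P a → Commute X P
  poly-commute XN none            = commute-𝟎
  poly-commute XN (addTerm p e t) = commute-⊕ (poly-commute XN p) (commute-⊛ e (commute-pow XN (suc t)))

  poly-upper : ∀ {n} {N P : Mat n} {a} → StrictlyUpper N → Poly N P a → StrictlyUpper P
  poly-upper N↑ none            i j j≤i = refl
  poly-upper N↑ (addTerm p e t) i j j≤i =
    trans (+-cong (poly-upper N↑ p i j j≤i) (trans (*-congˡ (pow-vanishes N↑ (suc t) i j j<t+i)) (zeroʳ e)))
          (+-identityʳ 0#)
    where
    j<t+i : toℕ j ℕ.< suc t ℕ.+ toℕ i
    j<t+i = s≤s (ℕP.≤-trans j≤i (ℕP.m≤n+m (toℕ i) t))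

  poly-superdiagonal : ∀ {n} {N P : Mat n} {a} → StrictlyUpper N → Poly N P a →
                       ∀ i j → toℕ j ≡ suc (toℕ i) → P i j ≈ a * N i j
  poly-superdiagonal N↑ none i j _ = sym (zeroˡ _)
  poly-superdiagonal {N = N} N↑ (addTerm {a = a} p e zero) i j j≡ = begin
    _ + e * (I · N) i j   ≈⟨ +-cong (poly-superdiagonal N↑ p i j j≡) (*-congˡ (·-identityˡ N i j)) ⟩
    a * N i j + e * N i j ≈⟨ distribʳ (N i j) a e ⟨
    (a + e) * N i j       ∎
  poly-superdiagonal {N = N} N↑ (addTerm {a = a} p e (suc t)) i j j≡ = begin
    _ + e * pow N (suc (suc t)) i j
      ≈⟨ +-cong (poly-superdiagonal N↑ p i j j≡) (*-congˡ (pow-vanishes N↑ (suc (suc t)) i j j<)) ⟩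
    a * N i j + e * 0#              ≈⟨ +-congˡ (zeroʳ e) ⟩
    a * N i j + 0#                  ≈⟨ +-identityʳ _ ⟩
    a * N i j                       ≈⟨ *-congʳ (+-identityʳ a) ⟨
    (a + 0#) * N i j                ∎
    where
    j< : toℕ j ℕ.< suc (suc t) ℕ.+ toℕ i
    j< = ≡.subst (ℕ._< suc (suc t) ℕ.+ toℕ i) (≡.sym j≡) (s≤s (s≤s (ℕP.m≤n+m (toℕ i) t)))

  block : ∀ {k} → Mat (suc k) → Mat k
  block A i j = A (fs i) (fs j)

  extend : ∀ {k} → (Fin (suc k) → Carrier) → Mat k → Mat (suc k)
  extend r B fz     j      = r j
  extend r B (fs i) fz     = 0#
  extend r B (fs i) (fs j) = B i j

  nilRow : ∀ {k} → Carrier → (Fin k → Carrier) → Fin (suc (suc k)) → Carrier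
  nilRow x r fz           = 0#
  nilRow x r (fs fz)      = x
  nilRow x r (fs (fs j))  = r j

  e₁ : ∀ {k} → Fin (suc (suc k)) → Carrier
  e₁ = nilRow 1# (λ _ → 0#)

  block-regular : ∀ {k} {N : Mat (suc k)} → Regular N → Regular (block N)
  block-regular N-reg = record
    { upper         = λ i j j≤i → upper N-reg (fs i) (fs j) (s≤s j≤i)
    ; superdiagonal = λ i j j≡ → superdiagonal N-reg (fs i) (fs j) (≡.cong suc j≡)
    }

  extend-regular : ∀ {k} {x r} {B : Mat (suc k)} → ¬ (x ≈ 0#) → Regular B → Regular (extend (nilRow x r) B)
  extend-regular {x = x} {r} {B} x≉0 B-reg = record { upper = up ; superdiagonal = sd }
    where
    up : StrictlyUpper (extend (nilRow x r) B)
    up fz     fz     _   = refl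
    up (fs i) fz     _   = refl
    up (fs i) (fs j) j≤i = upper B-reg i j (ℕ.s≤s⁻¹ j≤i)
    sd : NonzeroSuperdiagonal (extend (nilRow x r) B)
    sd fz     (fs fz) _  = x≉0
    sd (fs i) (fs j)  j≡ = superdiagonal B-reg i j (ℕP.suc-injective j≡)

  first-row-and-block : ∀ {k} {M N : Mat (suc k)} → StrictlyUpper M → StrictlyUpper N →
                        (∀ j → M fz j ≈ N fz j) → block M ≋ block N → M ≋ N
  first-row-and-block M↑ N↑ rows blocks fz     j      = rows j
  first-row-and-block M↑ N↑ rows blocks (fs i) fz     = trans (M↑ (fs i) fz z≤n) (sym (N↑ (fs i) fz z≤n))
  first-row-and-block M↑ N↑ rows blocks (fs i) (fs j) = blocks i j

-- Regular nilpotent matrices over a field: centralizers and normal forms.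
module OverAField {c ℓ} {F : CommutativeRing c ℓ} (isField : IsField F) where
  open CommutativeRing F
  open IsField isField
  open Matrices F
  open MatrixAlgebra F
  open NilpotentMatrices F
  open import Algebra.Properties.Group +-group using (ε⁻¹≈ε)
  open import Relation.Binary.Reasoning.Setoid setoid

  1≉0 : ¬ (1# ≈ 0#)
  1≉0 1≈0 = 0≉1 (sym 1≈0)

  cancel-nonzero : ∀ {a x y} → ¬ (a ≈ 0#) → a * x ≈ a * y → x ≈ y
  cancel-nonzero {a} {x} {y} a≉0 ax≈ay = begin
    x           ≈⟨ *-identityˡ x ⟨
    1# * x      ≈⟨ *-congʳ b*a≈1 ⟨
    (b * a) * x ≈⟨ *-assoc b a x ⟩
    b * (a * x) ≈⟨ *-congˡ ax≈ay ⟩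
    b * (a * y) ≈⟨ *-assoc b a y ⟨
    (b * a) * y ≈⟨ *-congʳ b*a≈1 ⟩
    1# * y      ≈⟨ *-identityˡ y ⟩
    y           ∎
    where
    b : Carrier
    b = proj₁ (inverse a a≉0)
    b*a≈1 : b * a ≈ 1#
    b*a≈1 = trans (*-comm b a) (proj₂ (inverse a a≉0))

  nonzero-* : ∀ {a b} → ¬ (a ≈ 0#) → ¬ (b ≈ 0#) → ¬ (a * b ≈ 0#)
  nonzero-* {a} a≉0 b≉0 ab≈0 = b≉0 (cancel-nonzero a≉0 (trans ab≈0 (sym (zeroʳ a))))

  -- For regular N the first row of Nᵗ is nonzero in column t: it is the product
  -- of the first t superdiagonal entries.
  first-row-pow-nonzero : ∀ {K} {N : Mat (suc K)} → Regular N → ∀ t k → toℕ k ≡ t → ¬ (pow N t fz k ≈ 0#)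
  first-row-pow-nonzero N-reg zero    fz     _  = 1≉0
  first-row-pow-nonzero {K} {N} N-reg (suc t) (fs k) k≡ Nᵗ⁺¹≈0 =
    nonzero-* (first-row-pow-nonzero N-reg t m m≡t) (superdiagonal N-reg m (fs k) (≡.cong suc (≡.sym m≡k)))
              (trans (sym (sum-single m other)) Nᵗ⁺¹≈0)
    where
    m : Fin (suc K)
    m = inject₁ k
    m≡k : toℕ m ≡ toℕ k
    m≡k = FinP.toℕ-inject₁ k
    m≡t : toℕ m ≡ t
    m≡t = ≡.trans m≡k (ℕP.suc-injective k≡)
    -- the only surviving term of (Nᵗ · N)₀ₖ₊₁ is l = k
    other : ∀ l → l ≢ m → pow N t fz l * N l (fs k) ≈ 0#
    other l l≢m with toℕ l ℕ.<? t
    ... | yes l<t = trans (*-congʳ (first-row-vanishes (upper N-reg) t l l<t)) (zeroˡ _)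
    ... | no  l≮t = trans (*-congˡ (upper N-reg l (fs k) (≡.subst (ℕ._≤ toℕ l) (≡.sym k≡) t<l))) (zeroʳ _)
      where
      t<l : t ℕ.< toℕ l
      t<l = ℕP.≤∧≢⇒< (ℕP.≮⇒≥ l≮t)
                      (λ t≡l → l≢m (FinP.toℕ-injective (≡.trans (≡.sym t≡l) (≡.sym m≡t))))

  -- A matrix commuting with a regular N is determined by its first row: comparing
  -- first rows of Nᵗ X = X Nᵗ determines row t from the rows below it.
  first-row-determines : ∀ {K} {N X Y : Mat (suc K)} → Regular N → Commute N X → Commute N Y →
                         (∀ j → X fz j ≈ Y fz j) → X ≋ Y
  first-row-determines {K} {N} {X} {Y} N-reg NX NY rows = WF.All.wfRec >-wellFounded ℓ RowAgrees step
    where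
    RowAgrees : Fin (suc K) → Set ℓ
    RowAgrees k = ∀ j → X k j ≈ Y k j

    shifted-rows : ∀ t j → (pow N t · X) fz j ≈ (pow N t · Y) fz j
    shifted-rows t j = begin
      (pow N t · X) fz j ≈⟨ commute-pow {X = X} (commute-sym {X = N} {Y = X} NX) t fz j ⟨
      (X · pow N t) fz j ≈⟨ ·-row {A = X} {A′ = Y} (pow N t) fz rows j ⟩
      (Y · pow N t) fz j ≈⟨ commute-pow {X = Y} (commute-sym {X = N} {Y = Y} NY) t fz j ⟩
      (pow N t · Y) fz j ∎

    step : ∀ k → WF.WfRec Fin._>_ RowAgrees k → RowAgrees k
    step k rows-below j = cancel-nonzero (first-row-pow-nonzero N-reg (toℕ k) k ≡.refl)
                                         (sum-cancel k agree (shifted-rows (toℕ k) j))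
      where
      agree : ∀ l → l ≢ k → pow N (toℕ k) fz l * X l j ≈ pow N (toℕ k) fz l * Y l j
      agree l l≢k with toℕ l ℕ.<? toℕ k
      ... | yes l<k = trans (*-congʳ Nᵏ≈0) (trans (zeroˡ _) (sym (trans (*-congʳ Nᵏ≈0) (zeroˡ _))))
        where
        Nᵏ≈0 : pow N (toℕ k) fz l ≈ 0#
        Nᵏ≈0 = first-row-vanishes (upper N-reg) (toℕ k) l l<k
      ... | no  l≮k = *-congˡ (rows-below k<l j)
        where
        k<l : toℕ k ℕ.< toℕ l
        k<l = ℕP.≤∧≢⇒< (ℕP.≮⇒≥ l≮k) (λ k≡l → l≢k (FinP.toℕ-injective (≡.sym k≡l)))

  -- Every row v with v₀ = 0 is the first row of a polynomial in a regular N; the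
  -- coefficients are found column by column, since Nᵗ⁺¹ vanishes left of column t+1.
  poly-with-first-row : ∀ {K} {N : Mat (suc K)} → Regular N → (v : Fin (suc K) → Carrier) → v fz ≈ 0# →
                        Σ (Mat (suc K)) λ P → Σ Carrier λ a → Poly N P a × (∀ j → P fz j ≈ v j)
  poly-with-first-row {K} {N} N-reg v v₀≈0 = solution (<-weakInduction MatchesUpTo base next (fromℕ K))
    where
    MatchesUpTo : Fin (suc K) → Set (c ⊔ ℓ)
    MatchesUpTo col = Σ (Mat (suc K)) λ P → Σ Carrier λ a →
                      Poly N P a × (∀ l → toℕ l ℕ.≤ toℕ col → P fz l ≈ v l)

    base : MatchesUpTo fz
    base = 𝟎 , 0# , none , λ { fz _ → sym v₀≈0 }

    next : ∀ i → MatchesUpTo (inject₁ i) → MatchesUpTo (fs i)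
    next i (P , a , p , matches) = P ⊕ e ⊛ pow N (suc t) , _ , addTerm p e t , matches′
      where
      t : ℕ
      t = toℕ i
      w : Carrier
      w = pow N (suc t) fz (fs i)
      w≉0 : ¬ (w ≈ 0#)
      w≉0 = first-row-pow-nonzero N-reg (suc t) (fs i) ≡.refl
      w⁻¹ : Carrier
      w⁻¹ = proj₁ (inverse w w≉0)
      w⁻¹*w≈1 : w⁻¹ * w ≈ 1#
      w⁻¹*w≈1 = trans (*-comm w⁻¹ w) (proj₂ (inverse w w≉0))
      e : Carrier
      e = (v (fs i) - P fz (fs i)) * w⁻¹
      matches′ : ∀ l → toℕ l ℕ.≤ suc t → P fz l + e * pow N (suc t) fz l ≈ v l
      matches′ l l≤t+1 with toℕ l ℕ.≤? t
      ... | yes l≤t = begin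
        P fz l + e * pow N (suc t) fz l ≈⟨ +-cong (matches l (≡.subst (toℕ l ℕ.≤_) (≡.sym (FinP.toℕ-inject₁ i)) l≤t))
                                                  (*-congˡ (first-row-vanishes (upper N-reg) (suc t) l (s≤s l≤t))) ⟩
        v l + e * 0#                    ≈⟨ +-congˡ (zeroʳ e) ⟩
        v l + 0#                        ≈⟨ +-identityʳ (v l) ⟩
        v l                             ∎
      ... | no  l≰t with ≡.refl ← FinP.toℕ-injective {i = l} {j = fs i} (ℕP.≤-antisym l≤t+1 (ℕP.≰⇒> l≰t))
        = begin
        P fz l + ((v l - P fz l) * w⁻¹) * w ≈⟨ +-congˡ (*-assoc _ w⁻¹ w) ⟩
        P fz l + (v l - P fz l) * (w⁻¹ * w) ≈⟨ +-congˡ (*-congˡ w⁻¹*w≈1) ⟩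
        P fz l + (v l - P fz l) * 1#        ≈⟨ +-congˡ (*-identityʳ _) ⟩
        P fz l + (v l - P fz l)             ≈⟨ +-difference (P fz l) (v l) ⟩
        v l                                 ∎

    solution : MatchesUpTo (fromℕ K) →
               Σ (Mat (suc K)) λ P → Σ Carrier λ a → Poly N P a × (∀ j → P fz j ≈ v j)
    solution (P , a , p , matches) = P , a , p , λ j →
      matches j (≡.subst (toℕ j ℕ.≤_) (≡.sym (FinP.toℕ-fromℕ K)) (ℕ.s≤s⁻¹ (FinP.toℕ<n j)))

  centralizer-poly : ∀ {K} {N X : Mat (suc K)} → Regular N → StrictlyUpper X → Commute X N →
                     Σ (Mat (suc K)) λ P → Σ Carrier λ a → Poly N P a × X ≋ P
  centralizer-poly {N = N} {X} N-reg X↑ XN with poly-with-first-row N-reg (X fz) (X↑ fz fz ℕP.≤-refl)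
  ... | P , a , p , row =
    P , a , p , first-row-determines N-reg (commute-sym {X = X} {Y = N} XN) (poly-commute {X = N} (commute-refl {X = N}) p)
                                     (λ j → sym (row j))

  centralizer-commutative : ∀ {K} {N X Y : Mat (suc K)} → Regular N → StrictlyUpper X → StrictlyUpper Y →
                            Commute X N → Commute Y N → Commute X Y
  centralizer-commutative {N = N} {X} {Y} N-reg X↑ Y↑ XN YN
    with centralizer-poly N-reg X↑ XN | centralizer-poly N-reg Y↑ YN
  ... | P , _ , p , X≋P | Q , _ , q , Y≋Q =
    commute-cong {X = P} {Y = Q} (λ i j → sym (X≋P i j)) (λ i j → sym (Y≋Q i j))
      (poly-commute {X = P} (commute-sym {X = N} {Y = P} (poly-commute {X = N} (commute-refl {X = N}) p)) q)

  record NormalForm {m} (N : Mat (suc (suc m))) : Set (c ⊔ ℓ) where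
    field
      matrix   : Mat (suc (suc m))
      linear   : Carrier
      poly     : Poly N matrix linear
      firstRow : ∀ j → matrix fz j ≈ e₁ j
  open NormalForm public

  normalForm : ∀ {m} {N : Mat (suc (suc m))} → Regular N → NormalForm N
  normalForm N-reg with poly-with-first-row N-reg e₁ refl
  ... | P , a , p , row = record { matrix = P ; linear = a ; poly = p ; firstRow = row }

  -- A normal form is itself regular: its superdiagonal is (linear coefficient) · N,
  -- and the coefficient is nonzero because the entry (0,1) is 1.
  normalForm-regular : ∀ {m} {N : Mat (suc (suc m))} → Regular N → (nf : NormalForm N) → Regular (matrix nf)
  normalForm-regular {N = N} N-reg nf = record
    { upper         = poly-upper (upper N-reg) (poly nf)
    ; superdiagonal = λ i j j≡ Pᵢⱼ≈0 →
        nonzero-* a≉0 (superdiagonal N-reg i j j≡)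
                  (trans (sym (poly-superdiagonal (upper N-reg) (poly nf) i j j≡)) Pᵢⱼ≈0)
    }
    where
    a≉0 : ¬ (linear nf ≈ 0#)
    a≉0 a≈0 = 1≉0 (begin
      1#                          ≈⟨ firstRow nf (fs fz) ⟨
      matrix nf fz (fs fz)        ≈⟨ poly-superdiagonal (upper N-reg) (poly nf) fz (fs fz) ≡.refl ⟩
      linear nf * N fz (fs fz)    ≈⟨ *-congʳ a≈0 ⟩
      0# * N fz (fs fz)           ≈⟨ zeroˡ _ ⟩
      0#                          ∎)

  -- Regular nilpotents with equal normal forms commute: both commute with that
  -- normal form, which is regular, so its strictly upper centralizer is commutative.
  same-normal-form-commute : ∀ {m} {M N : Mat (suc (suc m))} → Regular M → Regular N →
                             (nfM : NormalForm M) (nfN : NormalForm N) → matrix nfM ≋ matrix nfN → Commute M N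
  same-normal-form-commute {M = M} {N} M-reg N-reg nfM nfN same =
    centralizer-commutative (normalForm-regular M-reg nfM) (upper M-reg) (upper N-reg)
      (poly-commute {X = M} (commute-refl {X = M}) (poly nfM))
      (commute-cong {X = N} {Y = matrix nfN} (λ _ _ → refl) (λ i j → sym (same i j))
        (poly-commute {X = N} (commute-refl {X = N}) (poly nfN)))

  product-nonzero : ∀ {k} {f : Fin k → Carrier} → (∀ i → ¬ (f i ≈ 0#)) → ¬ (Π[ f ] ≈ 0#)
  product-nonzero {zero}  _   = 1≉0
  product-nonzero {suc k} f≉0 = nonzero-* (f≉0 fz) (product-nonzero (f≉0 ∘ fs))

  factor-nonzero : ∀ {k} {f : Fin k → Carrier} → ¬ (Π[ f ] ≈ 0#) → ∀ i → ¬ (f i ≈ 0#)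
  factor-nonzero {suc k} Π≉0 fz     f₀≈0 = Π≉0 (trans (*-congʳ f₀≈0) (zeroˡ _))
  factor-nonzero {suc k} {f} Π≉0 (fs i) fᵢ≈0 =
    factor-nonzero {f = f ∘ fs} (λ Π′≈0 → Π≉0 (trans (*-congˡ Π′≈0) (zeroʳ _))) i fᵢ≈0

  superdiagonal⇒product : ∀ {m} {A : Mat (suc m)} → NonzeroSuperdiagonal A → ¬ (superdiagProd A ≈ 0#)
  superdiagonal⇒product A-sd =
    product-nonzero (λ i → A-sd (inject₁ i) (fs i) (≡.cong suc (≡.sym (FinP.toℕ-inject₁ i))))

  product⇒superdiagonal : ∀ {m} {A : Mat (suc m)} → ¬ (superdiagProd A ≈ 0#) → NonzeroSuperdiagonal A
  product⇒superdiagonal {A = A} Π≉0 i (fs j) j≡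
    with ≡.refl ← FinP.toℕ-injective {i = i} {j = inject₁ j}
                    (≡.trans (ℕP.suc-injective (≡.sym j≡)) (≡.sym (FinP.toℕ-inject₁ j)))
    = factor-nonzero {f = λ k → A (inject₁ k) (fs k)} Π≉0 j

  S₀⇒regular : ∀ {m} {A : Mat (suc m)} → InS₀ A → Regular (A ⊖ I)
  S₀⇒regular {A = A} ((diagonal , below) , Π≉0) = record { upper = up ; superdiagonal = sd }
    where
    up : StrictlyUpper (A ⊖ I)
    up i j j≤i with ℕP.m≤n⇒m<n∨m≡n j≤i
    ... | inj₁ j<i = trans (+-cong (below i j j<i) (-‿cong (reflexive (I-below i j j<i)))) (-‿inverseʳ 0#)
    ... | inj₂ j≡i with ≡.refl ← FinP.toℕ-injective j≡i =
      trans (+-cong (diagonal i) (-‿cong (reflexive (I-diagonal i)))) (-‿inverseʳ 1#)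
    sd : NonzeroSuperdiagonal (A ⊖ I)
    sd i j j≡ Aᵢⱼ-Iᵢⱼ≈0 = product⇒superdiagonal {A = A} Π≉0 i j j≡ (begin
      A i j         ≈⟨ +-identityʳ (A i j) ⟨
      A i j + 0#    ≈⟨ +-congˡ ε⁻¹≈ε ⟨
      A i j - 0#    ≈⟨ +-congˡ (-‿cong (reflexive (I-superdiagonal i j j≡))) ⟨
      A i j - I i j ≈⟨ Aᵢⱼ-Iᵢⱼ≈0 ⟩
      0#            ∎)

  regular⇒S₀ : ∀ {m} {N : Mat (suc m)} → Regular N → InS₀ (I ⊕ N)
  regular⇒S₀ {N = N} N-reg = (diagonal , below) , superdiagonal⇒product sd
    where
    diagonal : ∀ i → I i i + N i i ≈ 1#
    diagonal i = trans (+-cong (reflexive (I-diagonal i)) (upper N-reg i i ℕP.≤-refl)) (+-identityʳ 1#)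
    below : ∀ i j → toℕ j ℕ.< toℕ i → I i j + N i j ≈ 0#
    below i j j<i = trans (+-cong (reflexive (I-below i j j<i)) (upper N-reg i j (ℕP.<⇒≤ j<i)))
                          (+-identityʳ 0#)
    sd : NonzeroSuperdiagonal (I ⊕ N)
    sd i j j≡ Iᵢⱼ+Nᵢⱼ≈0 = superdiagonal N-reg i j j≡ (begin
      N i j         ≈⟨ +-identityˡ (N i j) ⟨
      0# + N i j    ≈⟨ +-congʳ (reflexive (I-superdiagonal i j j≡)) ⟨
      I i j + N i j ≈⟨ Iᵢⱼ+Nᵢⱼ≈0 ⟩
      0#            ∎)

-- count k is the number of regular nilpotents of size k+1 over q′+1 elements:
-- at size k+2 there are q′ choices of the entry (0,1), (q′+1)ᵏ of the rest of
-- the first row, and count k of the lower-right block.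
module Count (q′ : ℕ) where
  open import Data.Nat using (_+_; _*_; _^_)
  open import Algebra.Properties.CommutativeSemigroup ℕP.*-commutativeSemigroup using (interchange)
  open ≡.≡-Reasoning

  count : ℕ → ℕ
  count zero    = 1
  count (suc k) = (q′ * suc q′ ^ k) * count k

  count-formula : ∀ m → count m ≡ q′ ^ m * suc q′ ^ (m C 2)
  count-formula zero    = ≡.refl
  count-formula (suc m) = begin
    (q′ * suc q′ ^ m) * count m                       ≡⟨ ≡.cong ((q′ * suc q′ ^ m) *_) (count-formula m) ⟩
    (q′ * suc q′ ^ m) * (q′ ^ m * suc q′ ^ (m C 2))
      ≡⟨ interchange q′ (suc q′ ^ m) (q′ ^ m) (suc q′ ^ (m C 2)) ⟩
    (q′ * q′ ^ m) * (suc q′ ^ m * suc q′ ^ (m C 2))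
      ≡⟨ ≡.cong ((q′ * q′ ^ m) *_) (ℕP.^-distribˡ-+-* (suc q′) m (m C 2)) ⟨
    q′ ^ suc m * suc q′ ^ (m + m C 2)                 ≡⟨ ≡.cong (λ e → q′ ^ suc m * suc q′ ^ e) pascal ⟩
    q′ ^ suc m * suc q′ ^ (suc m C 2)                 ∎
    where
    pascal : m + m C 2 ≡ suc m C 2
    pascal = ≡.trans (≡.cong (_+ m C 2) (≡.sym (nC1≡n m))) (nCk+nC[k+1]≡[n+1]C[k+1] m 1)

-- Regular nilpotent matrices of size k+1 over a commutative ring with q′+1
-- elements are counted by an explicit encoding into Fin (count k): a matrix is
-- coded by its nonzero entry (0,1), the rest of its first row, and its block.
module Enumeration {c ℓ} {F : CommutativeRing c ℓ} (q′ : ℕ)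
                   (counting : Inverse (CommutativeRing.setoid F) (≡.setoid (Fin (suc q′)))) where
  open CommutativeRing F
  open Matrices F
  open MatrixAlgebra F
  open NilpotentMatrices F
  open Count q′

  toFin : Carrier → Fin (suc q′)
  toFin = Inverse.to counting

  fromFin : Fin (suc q′) → Carrier
  fromFin = Inverse.from counting

  toFin-fromFin : ∀ a → toFin (fromFin a) ≡ a
  toFin-fromFin = Inverse.strictlyInverseˡ counting

  toFin-injective : ∀ {x y} → toFin x ≡ toFin y → x ≈ y
  toFin-injective {x} {y} eq = trans (sym (fromFin-toFin x)) (trans (Inverse.from-cong counting eq) (fromFin-toFin y))
    where fromFin-toFin = Inverse.strictlyInverseʳ counting

  encodeNonzero : (x : Carrier) → ¬ (x ≈ 0#) → Fin q′
  encodeNonzero x x≉0 = Fin.punchOut {i = toFin 0#} {j = toFin x} (λ eq → x≉0 (toFin-injective (≡.sym eq)))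

  decodeNonzero : Fin q′ → Carrier
  decodeNonzero a = fromFin (punchIn (toFin 0#) a)

  decodeNonzero-nonzero : ∀ a → ¬ (decodeNonzero a ≈ 0#)
  decodeNonzero-nonzero a a≈0 =
    FinP.punchInᵢ≢i (toFin 0#) a (≡.trans (≡.sym (toFin-fromFin _)) (Inverse.to-cong counting a≈0))

  encodeNonzero-cong : ∀ {x y} x≉0 y≉0 → x ≈ y → encodeNonzero x x≉0 ≡ encodeNonzero y y≉0
  encodeNonzero-cong _ _ x≈y = FinP.punchOut-cong (toFin 0#) (Inverse.to-cong counting x≈y)

  encodeNonzero-injective : ∀ {x y} x≉0 y≉0 → encodeNonzero x x≉0 ≡ encodeNonzero y y≉0 → x ≈ y
  encodeNonzero-injective {x} {y} _ _ eq =
    toFin-injective (FinP.punchOut-injective {i = toFin 0#} {j = toFin x} {k = toFin y} _ _ eq)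

  encodeNonzero-decode : ∀ a a≉0 → encodeNonzero (decodeNonzero a) a≉0 ≡ a
  encodeNonzero-decode a _ =
    ≡.trans (FinP.punchOut-cong (toFin 0#) (toFin-fromFin (punchIn (toFin 0#) a))) (FinP.punchOut-punchIn (toFin 0#))

  encodeRow : ∀ {k} → (Fin k → Carrier) → Fin (suc q′ ℕ.^ k)
  encodeRow f = funToFin (toFin ∘ f)

  decodeRow : ∀ {k} → Fin (suc q′ ℕ.^ k) → Fin k → Carrier
  decodeRow a = fromFin ∘ finToFun a

  funToFin-cong : ∀ {k n} {g h : Fin k → Fin n} → (∀ j → g j ≡ h j) → funToFin g ≡ funToFin h
  funToFin-cong {zero}  g≡h = ≡.refl
  funToFin-cong {suc k} g≡h = ≡.cong₂ combine (g≡h fz) (funToFin-cong (g≡h ∘ fs))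

  encodeRow-cong : ∀ {k} {f g : Fin k → Carrier} → (∀ j → f j ≈ g j) → encodeRow f ≡ encodeRow g
  encodeRow-cong f≈g = funToFin-cong (Inverse.to-cong counting ∘ f≈g)

  encodeRow-injective : ∀ {k} {f g : Fin k → Carrier} → encodeRow f ≡ encodeRow g → ∀ j → f j ≈ g j
  encodeRow-injective {f = f} {g} eq j = toFin-injective (begin
    toFin (f j)                           ≡⟨ FinP.finToFun-funToFin (toFin ∘ f) j ⟨
    finToFun (funToFin (toFin ∘ f)) j     ≡⟨ ≡.cong (λ a → finToFun a j) eq ⟩
    finToFun (funToFin (toFin ∘ g)) j     ≡⟨ FinP.finToFun-funToFin (toFin ∘ g) j ⟩
    toFin (g j)                           ∎)
    where open ≡.≡-Reasoning

  encodeRow-decode : ∀ {k} (a : Fin (suc q′ ℕ.^ k)) → encodeRow {k} (decodeRow a) ≡ a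
  encodeRow-decode {k} a = ≡.trans (funToFin-cong {k} (λ j → toFin-fromFin (finToFun a j))) (FinP.funToFin-finToFin {k} a)

  encodeFirstRow : ∀ {k} (N : Mat (suc (suc k))) → Regular N → Fin (q′ ℕ.* suc q′ ℕ.^ k)
  encodeFirstRow N N-reg = combine (encodeNonzero (N fz (fs fz)) (corner-nonzero N-reg)) (encodeRow (λ j → N fz (fs (fs j))))

  decodeFirstRow : ∀ {k} → Fin (q′ ℕ.* suc q′ ℕ.^ k) → Fin (suc (suc k)) → Carrier
  decodeFirstRow {k} a = nilRow (decodeNonzero (proj₁ codes)) (decodeRow (proj₂ codes))
    where
    codes : Fin q′ × Fin (suc q′ ℕ.^ k)
    codes = remQuot (suc q′ ℕ.^ k) a

  encodeFirstRow-cong : ∀ {k} {M N : Mat (suc (suc k))} M-reg N-reg → (∀ j → M fz j ≈ N fz j) →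
                        encodeFirstRow M M-reg ≡ encodeFirstRow N N-reg
  encodeFirstRow-cong M-reg N-reg rows =
    ≡.cong₂ combine (encodeNonzero-cong (corner-nonzero M-reg) (corner-nonzero N-reg) (rows (fs fz)))
                    (encodeRow-cong (λ j → rows (fs (fs j))))

  encodeFirstRow-injective : ∀ {k} {M N : Mat (suc (suc k))} M-reg N-reg →
                             encodeFirstRow M M-reg ≡ encodeFirstRow N N-reg → ∀ j → M fz j ≈ N fz j
  encodeFirstRow-injective M-reg N-reg codes≡ fz          = trans (upper M-reg fz fz z≤n) (sym (upper N-reg fz fz z≤n))
  encodeFirstRow-injective {M = M} {N} M-reg N-reg codes≡ (fs fz)     =
    encodeNonzero-injective (corner-nonzero M-reg) (corner-nonzero N-reg)
      (FinP.combine-injectiveˡ _ (encodeRow (λ j → M fz (fs (fs j)))) _ (encodeRow (λ j → N fz (fs (fs j)))) codes≡)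
  encodeFirstRow-injective {M = M} {N} M-reg N-reg codes≡ (fs (fs j)) =
    encodeRow-injective (FinP.combine-injectiveʳ (encodeNonzero (M fz (fs fz)) (corner-nonzero M-reg)) _
                                                 (encodeNonzero (N fz (fs fz)) (corner-nonzero N-reg)) _ codes≡) j

  encodeFirstRow-decode : ∀ {k} a (B : Mat (suc k)) reg → encodeFirstRow (extend (decodeFirstRow a) B) reg ≡ a
  encodeFirstRow-decode {k} a B reg = begin
    encodeFirstRow (extend (decodeFirstRow a) B) reg
      ≡⟨ ≡.cong₂ combine (encodeNonzero-decode x (corner-nonzero reg)) (encodeRow-decode {k} r) ⟩
    combine x r
      ≡⟨ FinP.combine-remQuot {q′} (suc q′ ℕ.^ k) a ⟩
    a ∎
    where
    open ≡.≡-Reasoning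
    x : Fin q′
    x = proj₁ (remQuot (suc q′ ℕ.^ k) a)
    r : Fin (suc q′ ℕ.^ k)
    r = proj₂ (remQuot {q′} (suc q′ ℕ.^ k) a)

  encode : ∀ k (N : Mat (suc k)) → Regular N → Fin (count k)
  encode zero    N N-reg = fz
  encode (suc k) N N-reg = combine (encodeFirstRow N N-reg) (encode k (block N) (block-regular N-reg))

  decode : ∀ k → Fin (count k) → Mat (suc k)
  decode zero    a = 𝟎
  decode (suc k) a = extend (decodeFirstRow (proj₁ parts)) (decode k (proj₂ parts))
    where
    parts : Fin (q′ ℕ.* suc q′ ℕ.^ k) × Fin (count k)
    parts = remQuot (count k) a

  decode-regular : ∀ k a → Regular (decode k a)
  decode-regular zero    a = record { upper = λ _ _ _ → refl ; superdiagonal = λ { fz fz () } }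
  decode-regular (suc k) a = extend-regular (decodeNonzero-nonzero _) (decode-regular k _)

  encode-cong : ∀ k {M N : Mat (suc k)} M-reg N-reg → M ≋ N → encode k M M-reg ≡ encode k N N-reg
  encode-cong zero    _     _     M≋N = ≡.refl
  encode-cong (suc k) M-reg N-reg M≋N =
    ≡.cong₂ combine (encodeFirstRow-cong M-reg N-reg (M≋N fz))
                    (encode-cong k (block-regular M-reg) (block-regular N-reg) (λ i j → M≋N (fs i) (fs j)))

  encode-injective : ∀ k {M N : Mat (suc k)} M-reg N-reg → encode k M M-reg ≡ encode k N N-reg → M ≋ N
  encode-injective zero    M-reg N-reg _ fz fz = trans (upper M-reg fz fz z≤n) (sym (upper N-reg fz fz z≤n))
  encode-injective (suc k) {M} {N} M-reg N-reg codes≡ =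
    first-row-and-block (upper M-reg) (upper N-reg)
      (encodeFirstRow-injective M-reg N-reg (FinP.combine-injectiveˡ _ blockM _ blockN codes≡))
      (encode-injective k (block-regular M-reg) (block-regular N-reg) (FinP.combine-injectiveʳ rowM _ rowN _ codes≡))
    where
    rowM rowN : Fin (q′ ℕ.* suc q′ ℕ.^ k)
    rowM = encodeFirstRow M M-reg
    rowN = encodeFirstRow N N-reg
    blockM blockN : Fin (count k)
    blockM = encode k (block M) (block-regular M-reg)
    blockN = encode k (block N) (block-regular N-reg)

  encode-decode : ∀ k a reg → encode k (decode k a) reg ≡ a
  encode-decode zero    fz _   = ≡.refl
  encode-decode (suc k) a  reg =
    ≡.trans (≡.cong₂ combine (encodeFirstRow-decode (proj₁ parts) (decode k (proj₂ parts)) reg)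
                             (encode-decode k (proj₂ parts) (block-regular reg)))
            (FinP.combine-remQuot {q′ ℕ.* suc q′ ℕ.^ k} (count k) a)
    where
    parts : Fin (q′ ℕ.* suc q′ ℕ.^ k) × Fin (count k)
    parts = remQuot (count k) a

module NonCommutingFamilies {c ℓ} {F : CommutativeRing c ℓ} (isField : IsField F) (q′ : ℕ)
                            (counting : Inverse (CommutativeRing.setoid F) (≡.setoid (Fin (suc q′)))) where
  open CommutativeRing F
  open Matrices F
  open MatrixAlgebra F
  open NilpotentMatrices F
  open OverAField isField
  open Count q′
  open Enumeration {F = F} q′ counting

  -- The matrices I + N with N regular of first row e₁ are pairwise non-commuting:
  -- commuting ones have nilpotent parts with a common first row, hence equal.
  lower-bound : ∀ m → Σ (Fin (count m) → Mat (suc (suc m))) λ X → NonCommutingFamilyInS₀ (count m) X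
  lower-bound m = (λ a → I ⊕ nilpotent a) , (λ a → regular⇒S₀ (nilpotent-regular a)) , non-commuting
    where
    nilpotent : Fin (count m) → Mat (suc (suc m))
    nilpotent a = extend e₁ (decode m a)

    nilpotent-regular : ∀ a → Regular (nilpotent a)
    nilpotent-regular a = extend-regular 1≉0 (decode-regular m a)

    non-commuting : ∀ a b → a ≢ b → ¬ Commute (I ⊕ nilpotent a) (I ⊕ nilpotent b)
    non-commuting a b a≢b commute = a≢b (begin
      a                                          ≡⟨ encode-decode m a (decode-regular m a) ⟨
      encode m (decode m a) (decode-regular m a) ≡⟨ encode-cong m _ _ (λ i j → same (fs i) (fs j)) ⟩
      encode m (decode m b) (decode-regular m b) ≡⟨ encode-decode m b (decode-regular m b) ⟩
      b                                          ∎)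
      where
      open ≡.≡-Reasoning
      same : nilpotent a ≋ nilpotent b
      same = first-row-determines (nilpotent-regular a) (commute-refl {X = nilpotent a})
               (commute-unipotent⁻ {M = nilpotent a} {N = nilpotent b} commute) (λ j → refl)

  -- A non-commuting family injects into the regular nilpotents of size m+1: send X
  -- to the lower-right block of the normal form of X − I.
  upper-bound : ∀ m k (X : Fin k → Mat (suc (suc m))) → NonCommutingFamilyInS₀ k X → k ℕ.≤ count m
  upper-bound m k X (X∈S₀ , non-commuting) = FinP.injective⇒≤ code-injective
    where
    nilpotent-regular : ∀ a → Regular (X a ⊖ I)
    nilpotent-regular a = S₀⇒regular (X∈S₀ a)

    nf : ∀ a → NormalForm (X a ⊖ I)
    nf a = normalForm (nilpotent-regular a)

    nf-regular : ∀ a → Regular (matrix (nf a))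
    nf-regular a = normalForm-regular (nilpotent-regular a) (nf a)

    code : Fin k → Fin (count m)
    code a = encode m (block (matrix (nf a))) (block-regular (nf-regular a))

    code-injective : Injective _≡_ _≡_ code
    code-injective {a} {b} codes≡ with a Fin.≟ b
    ... | yes a≡b = a≡b
    ... | no  a≢b = ⊥-elim (non-commuting a b a≢b (commute-⊖I {A = X a} {B = X b}
                      (same-normal-form-commute (nilpotent-regular a) (nilpotent-regular b) (nf a) (nf b) same-nf)))
      where
      same-nf : matrix (nf a) ≋ matrix (nf b)
      same-nf = first-row-and-block (upper (nf-regular a)) (upper (nf-regular b))
                  (λ j → trans (firstRow (nf a) j) (sym (firstRow (nf b) j)))
                  (encode-injective m _ _ codes≡)

open import Data.Nat using (_≤_; _∸_; _^_; _*_)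

theorem3p5 : ∀ {c ℓ} (n q : ℕ) → 2 ≤ n → IsPrimePower q →
    (F : CommutativeRing c ℓ) → IsFiniteField F q →
    Matrices.ωS₀≡ F n ((q ∸ 1) ^ (n ∸ 2) * q ^ ((n ∸ 2) C 2))
theorem3p5 zero          _        ()       _ _ _
theorem3p5 (suc zero)    _        (s≤s ()) _ _ _
-- a field has at least the element 0, so q ≠ 0
theorem3p5 (suc (suc m)) zero     _        _ F ff =
  ⊥-elim (FinP.¬Fin0 (Inverse.to (IsFiniteField.counting ff) (CommutativeRing.0# F)))
-- the bounds meet at count m = (q-1)^m q^C(m,2)
theorem3p5 (suc (suc m)) (suc q′) _        _ F ff =
  ≡.subst (Matrices.ωS₀≡ F (suc (suc m))) (count-formula m) (lower-bound m , upper-bound m)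
  where
  open Count q′
  open NonCommutingFamilies (finite⇒field ff) q′ (IsFiniteField.counting ff)
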